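{- Let $X$ be a cubic vertex-transitive graph for which $1$ is a simple eigenvalue, and let $\mathbf{z}\in\{1,-1\}^{V(X)}$ be an eigenvector of $X$ for eigenvalue $1$. Let $V^+=\{x\mid \mathbf{z}(x)=1\}$, $V^-=\{x\mid\mathbf{z}(x)=-1\}$, and let $M$ be the set of edges of $X$ with one end in $V^+$ and the other in $V^-$. Then: (i) $X[V^+]$ is a disjoint union of cycles of the same length; (ii) $X[V^+]$ is isomorphic to $X[V^-]$, and $V^+$ and $V^-$ are blocks of imprimitivity of the action of $\mathrm{Aut}(X)$; (iii) $\{V^+,V^-\}$ is the unique partition of $V(X)$ into two parts both inducing $2$-regular subgraphs; (iv) $M$ is a perfect matching of $X$; (v) $\mathrm{Aut}(X)$ fixes $M$ setwise and acts arc-transitively on $M$.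
   Context: Eigenvalues/eigenvectors are those of the adjacency matrix; a simple eigenvalue has one-dimensional eigenspace. For $W\subseteq V(X)$, $X[W]$ denotes the induced subgraph. -}

module Defs where

open import Data.Nat using (ℕ; zero; suc; _∸_)
open import Data.Fin using (Fin; toℕ)
open import Data.Fin.Permutation using (Permutation′; _⟨$⟩ʳ_)
open import Data.Bool using (Bool; true; false; if_then_else_; _∧_; _∨_)
open import Data.List using (List; map; foldr; allFin)
open import Data.Rational using (ℚ; 0ℚ; 1ℚ; _+_; _*_; -_; _≟_)
open import Data.Product using (Σ; ∃; _×_; _,_; proj₁; proj₂)
open import Data.Sum using (_⊎_)
open import Relation.Binary.PropositionalEquality using (_≡_; _≢_)
open import Relation.Nullary using (¬_)
open import Relation.Nullary.Decidable using (⌊_⌋)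
open import Function.Bundles using (_↔_; Inverse; _⇔_)

record Graph (n : ℕ) : Set where
  field
    adj    : Fin n → Fin n → Bool
    sym    : ∀ x y → adj x y ≡ adj y x
    irrefl : ∀ x → adj x x ≡ false
open Graph public

count : ∀ {n} → (Fin n → Bool) → ℕ
count {n} p = foldr (λ b k → if b then suc k else k) 0 (map p (allFin n))

degree : ∀ {n} → Graph n → Fin n → ℕ
degree X x = count (λ y → adj X x y)

Cubic : ∀ {n} → Graph n → Set
Cubic X = ∀ x → degree X x ≡ 3

IsAut : ∀ {n} → Graph n → Permutation′ n → Set
IsAut X σ = ∀ x y → adj X (σ ⟨$⟩ʳ x) (σ ⟨$⟩ʳ y) ≡ adj X x y

VertexTransitive : ∀ {n} → Graph n → Set
VertexTransitive {n} X =
  ∀ x y → Σ (Permutation′ n) (λ σ → IsAut X σ × (σ ⟨$⟩ʳ x ≡ y))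

sumℚ : ∀ {n} → (Fin n → ℚ) → ℚ
sumℚ {n} f = foldr _+_ 0ℚ (map f (allFin n))

adjMul : ∀ {n} → Graph n → (Fin n → ℚ) → Fin n → ℚ
adjMul X v x = sumℚ (λ y → if adj X x y then v y else 0ℚ)

IsEigenvector : ∀ {n} → Graph n → ℚ → (Fin n → ℚ) → Set
IsEigenvector X λ' v = (Σ _ (λ x → v x ≢ 0ℚ)) × (∀ x → adjMul X v x ≡ λ' * v x)

SimpleEigenvalue : ∀ {n} → Graph n → ℚ → Set
SimpleEigenvalue {n} X λ' =
  Σ (Fin n → ℚ) (λ v → IsEigenvector X λ' v ×
    (∀ (w : Fin n → ℚ) → (∀ x → adjMul X w x ≡ λ' * w x) →
       Σ ℚ (λ c → ∀ x → w x ≡ c * v x)))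

Subset : ℕ → Set
Subset n = Fin n → Bool

_∈_ : ∀ {n} → Fin n → Subset n → Set
x ∈ S = S x ≡ true

IVertex : ∀ {n} → Subset n → Set
IVertex {n} S = Σ (Fin n) (λ x → x ∈ S)

IEdge : ∀ {n} (X : Graph n) (S : Subset n) → IVertex S → IVertex S → Set
IEdge X S a b = adj X (proj₁ a) (proj₁ b) ≡ true

TwoRegularInduced : ∀ {n} → Graph n → Subset n → Set
TwoRegularInduced X S = ∀ x → x ∈ S → count (λ y → adj X x y ∧ S y) ≡ 2

record GraphIso (V W : Set) (E : V → V → Set) (F : W → W → Set) : Set where
  field
    bij      : V ↔ W
    preserve : ∀ a b → E a b ⇔ F (Inverse.to bij a) (Inverse.to bij b)

-- disjoint union of m cycles, each of length k (intended k ≥ 3):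
-- vertices (i , a), with a ~ a±1 (mod k) inside the same copy i
CyclesEdge : (m k : ℕ) → (Fin m × Fin k) → (Fin m × Fin k) → Set
CyclesEdge m k (i , a) (j , b) =
  i ≡ j × ( toℕ b ≡ suc (toℕ a) ⊎ toℕ a ≡ suc (toℕ b)
          ⊎ (toℕ a ≡ 0 × toℕ b ≡ k ∸ 1) ⊎ (toℕ b ≡ 0 × toℕ a ≡ k ∸ 1))

IsBlock : ∀ {n} → Graph n → Subset n → Set
IsBlock {n} X B = ∀ (σ : Permutation′ n) → IsAut X σ →
  (∀ x → (x ∈ B) ⇔ ((σ ⟨$⟩ʳ x) ∈ B)) ⊎ (∀ x → x ∈ B → ¬ ((σ ⟨$⟩ʳ x) ∈ B))

Vplus : ∀ {n} → (Fin n → ℚ) → Subset n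
Vplus z x = ⌊ z x ≟ 1ℚ ⌋

Vminus : ∀ {n} → (Fin n → ℚ) → Subset n
Vminus z x = ⌊ z x ≟ - 1ℚ ⌋

inM : ∀ {n} → Graph n → (Fin n → ℚ) → Fin n → Fin n → Bool
inM X z x y = adj X x y ∧ ((Vplus z x ∧ Vminus z y) ∨ (Vminus z x ∧ Vplus z y))

PerfectMatching : ∀ {n} → (Fin n → Fin n → Bool) → Set
PerfectMatching M = ∀ x → count (λ y → M x y) ≡ 1

FixesSetwise : ∀ {n} → Graph n → (Fin n → Fin n → Bool) → Set
FixesSetwise {n} X M = ∀ (σ : Permutation′ n) → IsAut X σ →
  ∀ x y → M (σ ⟨$⟩ʳ x) (σ ⟨$⟩ʳ y) ≡ M x y

ArcTransitiveOn : ∀ {n} → Graph n → (Fin n → Fin n → Bool) → Set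
ArcTransitiveOn {n} X M = ∀ x y x' y' → M x y ≡ true → M x' y' ≡ true →
  Σ (Permutation′ n) (λ σ → IsAut X σ × (σ ⟨$⟩ʳ x ≡ x') × (σ ⟨$⟩ʳ y ≡ y'))

-- Write z = sign ∘ V⁺. In a cubic graph, z(x) = Σ_{y ~ x} z(y) says exactly that every vertex has
-- two neighbours on its own side and one on the other, i.e. V⁺ and V⁻ both induce 2-regular
-- subgraphs and the edges between them form a perfect matching. Conversely the ±1 vector of any
-- partition into two 2-regular parts is an eigenvector for 1, so simplicity of 1 forces the
-- partition to be {V⁺, V⁻}. An automorphism maps {V⁺, V⁻} to such a partition, hence fixes or swaps
-- V⁺ and V⁻: these are blocks, the matching is invariant, and vertex-transitivity yields an
-- automorphism swapping them as well as transitivity of the stabiliser of V⁺ on V⁺. Finally, in a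
-- 2-regular graph the non-backtracking walk from an arc traces the cycle through it; when the
-- automorphisms act transitively on the vertices, every vertex lies on an image of one such cycle,
-- so the graph is a disjoint union of cycles of a common length.
module Submission where

open import Defs hiding (sym)
import Algebra.Properties.CommutativeMonoid.Sum as CommutativeMonoidSum
open import Axiom.UniquenessOfIdentityProofs using (module Decidable⇒UIP)
open import Data.Bool using (Bool; true; false; not; _∧_; _∨_; _xor_; if_then_else_)
import Data.Bool.Properties as Bool
open import Data.Empty using (⊥-elim)
open import Data.Fin using (Fin; zero; suc; toℕ; punchIn; combine; fromℕ<)
import Data.Fin.Properties as Fin
open import Data.Fin.Properties using (_≟_)
open import Data.Fin.Permutation using (Permutation′; _⟨$⟩ʳ_; _⟨$⟩ˡ_; inverseʳ; inverseˡ)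
open import Data.List using (map; foldr; allFin)
open import Data.List.Properties using (map-tabulate)
open import Data.Nat using (ℕ; zero; suc; _+_; _*_; _∸_; _≤_; _<_; z≤n; s≤s)
open import Data.Nat.GeneralisedArithmetic using (fold; fold-+)
open import Data.Nat.Induction using (<-rec)
import Data.Nat.Properties as ℕ
open import Data.Product using (Σ; ∃; _×_; _,_; proj₁; proj₂)
open import Data.Product.Properties using (≡-dec)
open import Data.Rational as ℚ using (ℚ; 0ℚ; 1ℚ; -_)
import Data.Rational.Properties as ℚ
open import Data.Rational.Solver using (module +-*-Solver)
open import Data.Sum as Sum using (_⊎_; inj₁; inj₂; [_,_]′)
import Data.Vec.Functional as Vector
open import Function using (_∘_; id)
open import Function.Bundles using (_⇔_; mk⇔; Equivalence; Inverse; mk↔ₛ′)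
open import Relation.Binary.Definitions using (tri<; tri≈; tri>)
open import Relation.Binary.PropositionalEquality
open import Relation.Nullary using (¬_; Dec; yes; no; does)
open import Relation.Nullary.Decidable using (⌊_⌋; dec-true; dec-false; _×-dec_)

private
  module ℕΣ = CommutativeMonoidSum ℕ.+-0-commutativeMonoid

true≢false : true ≢ false
true≢false ()

from-does-true : ∀ {A : Set} (a? : Dec A) → does a? ≡ true → A
from-does-true (yes a) _ = a

⟨$⟩ʳ-injective : ∀ {n} (σ : Permutation′ n) {x y} → σ ⟨$⟩ʳ x ≡ σ ⟨$⟩ʳ y → x ≡ y
⟨$⟩ʳ-injective σ eq = trans (sym (inverseˡ σ)) (trans (cong (σ ⟨$⟩ˡ_) eq) (inverseˡ σ))

no-loop : ∀ {n} (X : Graph n) {y} → adj X y y ≢ true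
no-loop X {y} y~y = true≢false (trans (sym y~y) (irrefl X y))

IVertex-≡ : ∀ {n} {T : Fin n → Bool} {x y} {Tx : T x ≡ true} {Ty : T y ≡ true} → x ≡ y →
  _≡_ {A = IVertex T} (x , Tx) (y , Ty)
IVertex-≡ {Tx = Tx} {Ty} refl = cong (_ ,_) (Decidable⇒UIP.≡-irrelevant Bool._≟_ Tx Ty)

-- Counting Boolean predicates on Fin n

foldr-map-allFin-suc : ∀ {A B : Set} {n} (g : A → B → B) (e : B) (f : Fin (suc n) → A) →
  foldr g e (map f (allFin (suc n))) ≡ g (f zero) (foldr g e (map (f ∘ suc) (allFin n)))
foldr-map-allFin-suc g e f =
  cong (g (f zero) ∘ foldr g e) (trans (map-tabulate suc f) (sym (map-tabulate id (f ∘ suc))))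

count-suc : ∀ {n} (p : Fin (suc n) → Bool) →
  count p ≡ (if p zero then suc (count (p ∘ suc)) else count (p ∘ suc))
count-suc = foldr-map-allFin-suc (λ b k → if b then suc k else k) 0

sumℚ-suc : ∀ {n} (f : Fin (suc n) → ℚ) → sumℚ f ≡ f zero ℚ.+ sumℚ (f ∘ suc)
sumℚ-suc = foldr-map-allFin-suc ℚ._+_ 0ℚ

bit : Bool → ℕ
bit b = if b then 1 else 0

count≡sum : ∀ {n} (p : Fin n → Bool) → count p ≡ ℕΣ.sum (bit ∘ p)
count≡sum {zero} p = refl
count≡sum {suc n} p = trans (count-suc p) (bump≡bit+ (p zero) (count≡sum (p ∘ suc)))
  where
  bump≡bit+ : ∀ b {k l} → k ≡ l → (if b then suc k else k) ≡ bit b + l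
  bump≡bit+ true k≡l = cong suc k≡l
  bump≡bit+ false k≡l = k≡l

count-cong : ∀ {n} {p q : Fin n → Bool} → (∀ x → p x ≡ q x) → count p ≡ count q
count-cong {p = p} {q} p≗q = begin
  count p            ≡⟨ count≡sum p ⟩
  ℕΣ.sum (bit ∘ p)   ≡⟨ ℕΣ.sum-cong-≗ (cong bit ∘ p≗q) ⟩
  ℕΣ.sum (bit ∘ q)   ≡⟨ count≡sum q ⟨
  count q            ∎
  where open ≡-Reasoning

count-split : ∀ {n} (p q : Fin n → Bool) →
  count p ≡ count (λ x → p x ∧ q x) + count (λ x → p x ∧ not (q x))
count-split p q = begin
  count p                                      ≡⟨ count≡sum p ⟩
  ℕΣ.sum (bit ∘ p)                             ≡⟨ ℕΣ.sum-cong-≗ (λ x → split-bit (p x) (q x)) ⟩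
  ℕΣ.sum (λ x → bit (p∧q x) + bit (p∧¬q x))    ≡⟨ ℕΣ.∑-distrib-+ (bit ∘ p∧q) (bit ∘ p∧¬q) ⟩
  ℕΣ.sum (bit ∘ p∧q) + ℕΣ.sum (bit ∘ p∧¬q)     ≡⟨ cong₂ _+_ (count≡sum p∧q) (count≡sum p∧¬q) ⟨
  count p∧q + count p∧¬q                       ∎
  where
  open ≡-Reasoning
  p∧q p∧¬q : _ → Bool
  p∧q x = p x ∧ q x
  p∧¬q x = p x ∧ not (q x)
  split-bit : ∀ a b → bit a ≡ bit (a ∧ b) + bit (a ∧ not b)
  split-bit true true = refl
  split-bit true false = refl
  split-bit false b = refl

count-permute : ∀ {n} (p : Fin n → Bool) (σ : Permutation′ n) → count (p ∘ (σ ⟨$⟩ʳ_)) ≡ count p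
count-permute p σ = begin
  count (p ∘ (σ ⟨$⟩ʳ_))          ≡⟨ count≡sum (p ∘ (σ ⟨$⟩ʳ_)) ⟩
  ℕΣ.sum (bit ∘ p ∘ (σ ⟨$⟩ʳ_))   ≡⟨ ℕΣ.sum-permute (bit ∘ p) σ ⟨
  ℕΣ.sum (bit ∘ p)               ≡⟨ count≡sum p ⟨
  count p                        ∎
  where open ≡-Reasoning

count-pos : ∀ {n} (p : Fin n → Bool) {x} → p x ≡ true → 0 < count p
count-pos {suc n} p {x} px = begin-strict
  0                                                    <⟨ subst (λ b → 0 < bit b) (sym px) (s≤s z≤n) ⟩
  bit (p x)                                            ≤⟨ ℕ.m≤m+n _ _ ⟩
  bit (p x) + ℕΣ.sum (Vector.removeAt (bit ∘ p) x)     ≡⟨ ℕΣ.sum-remove (bit ∘ p) ⟨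
  ℕΣ.sum (bit ∘ p)                                     ≡⟨ count≡sum p ⟨
  count p                                              ∎
  where open ℕ.≤-Reasoning

count-witness : ∀ {n} (p : Fin n → Bool) → 0 < count p → ∃ λ x → p x ≡ true
count-witness {n} p 0<count with Fin.any? (λ x → p x Bool.≟ true)
... | yes witness = witness
... | no none = ⊥-elim (ℕ.<⇒≢ 0<count (sym (begin
  count p              ≡⟨ count≡sum p ⟩
  ℕΣ.sum (bit ∘ p)     ≡⟨ ℕΣ.sum-cong-≗ (λ x → cong bit (Bool.¬-not (none ∘ (x ,_)))) ⟩
  ℕΣ.sum {n} (λ _ → 0) ≡⟨ ℕΣ.sum-replicate-zero n ⟩
  0                    ∎)))
  where open ≡-Reasoning

_except_ : ∀ {n} → (Fin n → Bool) → Fin n → Fin n → Bool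
(p except a) y = p y ∧ not (does (y ≟ a))

except-intro : ∀ {n} (p : Fin n → Bool) {a y} → p y ≡ true → y ≢ a → (p except a) y ≡ true
except-intro p {a} {y} py y≢a = cong₂ _∧_ py (cong not (dec-false (y ≟ a) y≢a))

except-elim : ∀ {n} (p : Fin n → Bool) {a y} → (p except a) y ≡ true → p y ≡ true × y ≢ a
except-elim p {a} {y} p-a-y =
  Bool.∧-conicalˡ (p y) _ p-a-y ,
  λ { refl → true≢false (trans (sym (Bool.∧-conicalʳ (p a) _ p-a-y)) (cong not (dec-true (a ≟ a) refl))) }

count-remove : ∀ {n} (p : Fin n → Bool) {a} → p a ≡ true → count p ≡ suc (count (p except a))
count-remove {suc n} p {a} pa = begin
  count p                                                 ≡⟨ count≡sum p ⟩
  ℕΣ.sum (bit ∘ p)                                        ≡⟨ ℕΣ.sum-remove (bit ∘ p) ⟩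
  bit (p a) + ℕΣ.sum (Vector.removeAt (bit ∘ p) a)        ≡⟨ cong₂ _+_ (cong bit pa) (ℕΣ.sum-cong-≗ agree-off-a) ⟩
  suc rest                                                ≡⟨ cong (λ b → suc (bit b + rest)) p-a-a ⟨
  suc (bit (p-a a) + rest)                                ≡⟨ cong suc (ℕΣ.sum-remove (bit ∘ p-a)) ⟨
  suc (ℕΣ.sum (bit ∘ p-a))                                ≡⟨ cong suc (count≡sum p-a) ⟨
  suc (count p-a)                                         ∎
  where
  open ≡-Reasoning
  p-a : Fin (suc n) → Bool
  p-a = p except a
  rest : ℕ
  rest = ℕΣ.sum (Vector.removeAt (bit ∘ p-a) a)
  p-a-a : p-a a ≡ false
  p-a-a = trans (cong (λ b → p a ∧ not b) (dec-true (a ≟ a) refl)) (Bool.∧-zeroʳ (p a))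
  agree-off-a : ∀ i → bit (p (punchIn a i)) ≡ bit (p-a (punchIn a i))
  agree-off-a i = cong bit (sym (trans
    (cong (λ b → p (punchIn a i) ∧ not b) (dec-false (punchIn a i ≟ a) (Fin.punchInᵢ≢i a i)))
    (Bool.∧-identityʳ (p (punchIn a i)))))

count≡1-unique : ∀ {n} (p : Fin n → Bool) {a b} → count p ≡ 1 → p a ≡ true → p b ≡ true → b ≡ a
count≡1-unique p {a} {b} count≡1 pa pb with b ≟ a
... | yes b≡a = b≡a
... | no b≢a = ⊥-elim (ℕ.<⇒≢ (count-pos (p except a) (except-intro p pb b≢a)) (sym count-p-a≡0))
  where
  count-p-a≡0 : count (p except a) ≡ 0
  count-p-a≡0 = ℕ.suc-injective (trans (sym (count-remove p pa)) count≡1)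

count≡2-other : ∀ {n} (p : Fin n → Bool) {a} → count p ≡ 2 → p a ≡ true → ∃ λ b → p b ≡ true × b ≢ a
count≡2-other p {a} count≡2 pa =
  let b , p-a-b = count-witness (p except a) (subst (0 <_) (sym count-p-a≡1) (s≤s z≤n))
  in b , except-elim p p-a-b
  where
  count-p-a≡1 : count (p except a) ≡ 1
  count-p-a≡1 = ℕ.suc-injective (trans (sym (count-remove p pa)) count≡2)

count≡2-unique : ∀ {n} (p : Fin n → Bool) {a b c} → count p ≡ 2 → p a ≡ true → p b ≡ true → b ≢ a →
  p c ≡ true → c ≢ a → c ≡ b
count≡2-unique p {a} count≡2 pa pb b≢a pc c≢a =
  count≡1-unique (p except a) (ℕ.suc-injective (trans (sym (count-remove p pa)) count≡2))
    (except-intro p pb b≢a) (except-intro p pc c≢a)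

degreeInto : ∀ {n} → Graph n → (Fin n → Bool) → Fin n → ℕ
degreeInto X S x = count (λ y → adj X x y ∧ S y)

cubic-degree-split : ∀ {n} (X : Graph n) → Cubic X → ∀ s x →
  degreeInto X s x + degreeInto X (not ∘ s) x ≡ 3
cubic-degree-split X cubic s x = trans (sym (count-split (adj X x) s)) (cubic x)

-- ±1 vectors

sign : Bool → ℚ
sign true = 1ℚ
sign false = - 1ℚ

toℚ : ℕ → ℚ
toℚ zero = 0ℚ
toℚ (suc k) = 1ℚ ℚ.+ toℚ k

sum-masked-signs : ∀ {n} (a s : Fin n → Bool) (v : Fin n → ℚ) → (∀ y → v y ≡ sign (s y)) →
  sumℚ (λ y → if a y then v y else 0ℚ) ≡
  toℚ (count (λ y → a y ∧ s y)) ℚ.- toℚ (count (λ y → a y ∧ not (s y)))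
sum-masked-signs {zero} a s v v≗ = refl
sum-masked-signs {suc n} a s v v≗ = begin
  sumℚ (λ y → if a y then v y else 0ℚ)
    ≡⟨ sumℚ-suc (λ y → if a y then v y else 0ℚ) ⟩
  (if a zero then v zero else 0ℚ) ℚ.+ sumℚ (λ y → if a (suc y) then v (suc y) else 0ℚ)
    ≡⟨ cong₂ (λ q r → (if a zero then q else 0ℚ) ℚ.+ r)
             (v≗ zero) (sum-masked-signs (a ∘ suc) (s ∘ suc) (v ∘ suc) (v≗ ∘ suc)) ⟩
  (if a zero then sign (s zero) else 0ℚ) ℚ.+ (toℚ P ℚ.- toℚ Q)
    ≡⟨ step (a zero) (s zero) ⟩
  toℚ (bump (a zero ∧ s zero) P) ℚ.- toℚ (bump (a zero ∧ not (s zero)) Q)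
    ≡⟨ cong₂ (λ k l → toℚ k ℚ.- toℚ l) (count-suc (λ y → a y ∧ s y)) (count-suc (λ y → a y ∧ not (s y))) ⟨
  toℚ (count (λ y → a y ∧ s y)) ℚ.- toℚ (count (λ y → a y ∧ not (s y))) ∎
  where
  open ≡-Reasoning
  open +-*-Solver
  P Q : ℕ
  P = count (λ y → a (suc y) ∧ s (suc y))
  Q = count (λ y → a (suc y) ∧ not (s (suc y)))
  bump : Bool → ℕ → ℕ
  bump b k = if b then suc k else k
  step : ∀ a₀ s₀ → (if a₀ then sign s₀ else 0ℚ) ℚ.+ (toℚ P ℚ.- toℚ Q) ≡
                   toℚ (bump (a₀ ∧ s₀) P) ℚ.- toℚ (bump (a₀ ∧ not s₀) Q)
  step true true = solve 2 (λ p q → con 1ℚ :+ (p :- q) := (con 1ℚ :+ p) :- q) refl (toℚ P) (toℚ Q)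
  step true false = solve 2 (λ p q → :- con 1ℚ :+ (p :- q) := p :- (con 1ℚ :+ q)) refl (toℚ P) (toℚ Q)
  step false _ = ℚ.+-identityˡ _

adjMul-signs : ∀ {n} (X : Graph n) (s : Fin n → Bool) (v : Fin n → ℚ) → (∀ y → v y ≡ sign (s y)) → ∀ x →
  adjMul X v x ≡ toℚ (degreeInto X s x) ℚ.- toℚ (degreeInto X (not ∘ s) x)
adjMul-signs X s v v≗ x = sum-masked-signs (adj X x) s v v≗

signed-three : ∀ b P Q → P + Q ≡ 3 → (toℚ P ℚ.- toℚ Q ≡ sign b) ⇔ ((if b then P else Q) ≡ 2)
signed-three true  0 .3 refl = mk⇔ (λ ()) (λ ())
signed-three true  1 .2 refl = mk⇔ (λ ()) (λ ())
signed-three true  2 .1 refl = mk⇔ (λ _ → refl) (λ _ → refl)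
signed-three true  3 .0 refl = mk⇔ (λ ()) (λ ())
signed-three false 0 .3 refl = mk⇔ (λ ()) (λ ())
signed-three false 1 .2 refl = mk⇔ (λ _ → refl) (λ _ → refl)
signed-three false 2 .1 refl = mk⇔ (λ ()) (λ ())
signed-three false 3 .0 refl = mk⇔ (λ ()) (λ ())
signed-three _ (suc (suc (suc (suc _)))) _ ()

module _ {n} (X : Graph n) (cubic : Cubic X) (s : Fin n → Bool) where

  sameSideDegree : Fin n → Bool → ℕ
  sameSideDegree x b = if b then degreeInto X s x else degreeInto X (not ∘ s) x

  eigenvalue-one-at : ∀ (v : Fin n → ℚ) → (∀ y → v y ≡ sign (s y)) → ∀ x →
    (adjMul X v x ≡ 1ℚ ℚ.* v x) ⇔
    (sameSideDegree x (s x) ≡ 2)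
  eigenvalue-one-at v v≗ x = mk⇔
    (λ eigen → Equivalence.to (signed-three (s x) _ _ (cubic-degree-split X cubic s x))
                 (trans (sym (adjMul-signs X s v v≗ x)) (trans eigen (trans (ℚ.*-identityˡ (v x)) (v≗ x)))))
    (λ own≡2 → trans (adjMul-signs X s v v≗ x)
                 (trans (Equivalence.from (signed-three (s x) _ _ (cubic-degree-split X cubic s x)) own≡2)
                        (sym (trans (ℚ.*-identityˡ (v x)) (v≗ x)))))

  eigenvector⇒two-regular : ∀ (v : Fin n → ℚ) → (∀ y → v y ≡ sign (s y)) →
    (∀ x → adjMul X v x ≡ 1ℚ ℚ.* v x) → TwoRegularInduced X s × TwoRegularInduced X (not ∘ s)
  eigenvector⇒two-regular v v≗ eigen =
    (λ x sx → subst (λ b → sameSideDegree x b ≡ 2) sx (own-side x)) ,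
    (λ x ¬sx → subst (λ b → sameSideDegree x b ≡ 2) (Bool.not-injective ¬sx) (own-side x))
    where
    own-side : ∀ x → sameSideDegree x (s x) ≡ 2
    own-side x = Equivalence.to (eigenvalue-one-at v v≗ x) (eigen x)

  two-regular⇒eigenvector : TwoRegularInduced X s → TwoRegularInduced X (not ∘ s) →
    ∀ x → adjMul X (sign ∘ s) x ≡ 1ℚ ℚ.* sign (s x)
  two-regular⇒eigenvector two-reg two-reg-not x =
    Equivalence.from (eigenvalue-one-at (sign ∘ s) (λ _ → refl) x) (own-side (s x) refl)
    where
    own-side : ∀ b → s x ≡ b → sameSideDegree x b ≡ 2
    own-side true sx = two-reg x sx
    own-side false sx = two-reg-not x (cong not sx)

  two-regular⇒cross-degree-one : TwoRegularInduced X s → ∀ x → s x ≡ true → degreeInto X (not ∘ s) x ≡ 1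
  two-regular⇒cross-degree-one two-reg x sx =
    ℕ.+-cancelˡ-≡ 2 _ _ (subst (λ k → k + degreeInto X (not ∘ s) x ≡ 3) (two-reg x sx) (cubic-degree-split X cubic s x))

eigenvectors-proportional : ∀ {n} (X : Graph n) {λ′} → SimpleEigenvalue X λ′ → ∀ {v w : Fin n → ℚ} →
  (∀ x → adjMul X v x ≡ λ′ ℚ.* v x) → (∀ x → adjMul X w x ≡ λ′ ℚ.* w x) →
  ∀ x y → v x ℚ.* w y ≡ v y ℚ.* w x
eigenvectors-proportional X (u , _ , spans) {v} {w} eigen-v eigen-w x y =
  let a , v≗au = spans v eigen-v
      b , w≗bu = spans w eigen-w
  in begin
    v x ℚ.* w y                 ≡⟨ cong₂ ℚ._*_ (v≗au x) (w≗bu y) ⟩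
    (a ℚ.* u x) ℚ.* (b ℚ.* u y) ≡⟨ solve 4 (λ a b p q → (a :* p) :* (b :* q) := (a :* q) :* (b :* p))
                                           refl a b (u x) (u y) ⟩
    (a ℚ.* u y) ℚ.* (b ℚ.* u x) ≡⟨ cong₂ ℚ._*_ (v≗au y) (w≗bu x) ⟨
    v y ℚ.* w x                 ∎
  where
  open ≡-Reasoning
  open +-*-Solver

sign-cancel : ∀ a b c → sign a ℚ.* sign c ≡ sign c ℚ.* sign b → a ≡ b
sign-cancel true  true  _     _ = refl
sign-cancel false false _     _ = refl
sign-cancel true  false true  ()
sign-cancel true  false false ()
sign-cancel false true  true  ()
sign-cancel false true  false ()

sign-flip : ∀ a b c → sign a ℚ.* sign c ≡ sign (not c) ℚ.* sign b → a ≡ not b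
sign-flip true  false _     _ = refl
sign-flip false true  _     _ = refl
sign-flip true  true  true  ()
sign-flip true  true  false ()
sign-flip false false true  ()
sign-flip false false false ()

≡-or-≡not : ∀ a b → a ≡ b ⊎ a ≡ not b
≡-or-≡not false false = inj₁ refl
≡-or-≡not false true  = inj₂ refl
≡-or-≡not true  false = inj₂ refl
≡-or-≡not true  true  = inj₁ refl

two-regular-partition-unique : ∀ {n} (X : Graph n) → Cubic X → SimpleEigenvalue X 1ℚ →
  ∀ (s : Fin n → Bool) (v : Fin n → ℚ) → (∀ x → v x ≡ sign (s x)) → (∀ x → adjMul X v x ≡ 1ℚ ℚ.* v x) →
  ∀ (P : Fin n → Bool) → TwoRegularInduced X P → TwoRegularInduced X (not ∘ P) →
  (∀ x → P x ≡ s x) ⊎ (∀ x → P x ≡ not (s x))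
two-regular-partition-unique {zero} _ _ _ _ _ _ _ _ _ _ = inj₁ (λ ())
two-regular-partition-unique {suc n} X cubic simple s v v≗ eigen-v P two-reg two-reg-not =
  Sum.map (λ P₀≡s₀ x → sign-cancel (P x) (s x) (s zero) (subst (CrossRatio x) P₀≡s₀ (cross x)))
          (λ P₀≡¬s₀ x → sign-flip (P x) (s x) (s zero) (subst (CrossRatio x) P₀≡¬s₀ (cross x)))
          (≡-or-≡not (P zero) (s zero))
  where
  CrossRatio : Fin (suc n) → Bool → Set
  CrossRatio x b = sign (P x) ℚ.* sign (s zero) ≡ sign b ℚ.* sign (s x)
  cross : ∀ x → CrossRatio x (P zero)
  cross x = subst₂ (λ p q → sign (P x) ℚ.* p ≡ sign (P zero) ℚ.* q) (v≗ zero) (v≗ x)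
    (eigenvectors-proportional X {1ℚ} simple {sign ∘ P} (two-regular⇒eigenvector X cubic P two-reg two-reg-not) eigen-v x zero)

two-regular-cong : ∀ {n} (X : Graph n) {S S′ : Fin n → Bool} → (∀ x → S x ≡ S′ x) →
  TwoRegularInduced X S → TwoRegularInduced X S′
two-regular-cong X S≗S′ two-reg x S′x =
  trans (count-cong λ y → cong (adj X x y ∧_) (sym (S≗S′ y))) (two-reg x (trans (S≗S′ x) S′x))

two-regular-∘-aut : ∀ {n} (X : Graph n) {σ : Permutation′ n} → IsAut X σ → ∀ {S} →
  TwoRegularInduced X S → TwoRegularInduced X (S ∘ (σ ⟨$⟩ʳ_))
two-regular-∘-aut X {σ} aut {S} two-reg x Sσx = begin
  degreeInto X (S ∘ (σ ⟨$⟩ʳ_)) x       ≡⟨ count-cong (λ y → cong (_∧ S (σ ⟨$⟩ʳ y)) (sym (aut x y))) ⟩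
  count (adjS-σx ∘ (σ ⟨$⟩ʳ_))          ≡⟨ count-permute adjS-σx σ ⟩
  degreeInto X S (σ ⟨$⟩ʳ x)            ≡⟨ two-reg (σ ⟨$⟩ʳ x) Sσx ⟩
  2                                    ∎
  where
  open ≡-Reasoning
  adjS-σx : Fin _ → Bool
  adjS-σx y = adj X (σ ⟨$⟩ʳ x) y ∧ S y

PreservedOrSwapped : ∀ {n} → Graph n → (Fin n → Bool) → Set
PreservedOrSwapped {n} X s = ∀ (σ : Permutation′ n) → IsAut X σ →
  (∀ x → s (σ ⟨$⟩ʳ x) ≡ s x) ⊎ (∀ x → s (σ ⟨$⟩ʳ x) ≡ not (s x))

aut-preserves-or-swaps : ∀ {n} (X : Graph n) → Cubic X → SimpleEigenvalue X 1ℚ →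
  ∀ (s : Fin n → Bool) (v : Fin n → ℚ) → (∀ x → v x ≡ sign (s x)) → (∀ x → adjMul X v x ≡ 1ℚ ℚ.* v x) →
  PreservedOrSwapped X s
aut-preserves-or-swaps X cubic simple s v v≗ eigen σ aut =
  let two-reg , two-reg-not = eigenvector⇒two-regular X cubic s v v≗ eigen
  in two-regular-partition-unique X cubic simple s v v≗ eigen (s ∘ (σ ⟨$⟩ʳ_))
       (two-regular-∘-aut X {σ} aut {s} two-reg) (two-regular-∘-aut X {σ} aut {not ∘ s} two-reg-not)

-- Non-backtracking walks in a 2-regular induced subgraph

pick : ∀ {m} → (Fin m → Bool) → Fin m → Fin m
pick p default with Fin.any? (λ y → p y Bool.≟ true)
... | yes (y , _) = y
... | no _ = default

pick-satisfies : ∀ {m} (p : Fin m → Bool) default {y} → p y ≡ true → p (pick p default) ≡ true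
pick-satisfies p default {y} py with Fin.any? (λ y → p y Bool.≟ true)
... | yes (_ , py′) = py′
... | no none = ⊥-elim (none (y , py))

least : ∀ {P : ℕ → Set} → (∀ d → Dec (P d)) → ∀ {d} → P d → ∃ λ k → P k × (∀ {j} → j < k → ¬ P j)
least {P} P? {d} = <-rec (λ d → P d → ∃ λ k → P k × (∀ {j} → j < k → ¬ P j)) search d
  where
  search : ∀ d → (∀ {j} → j < d → P j → ∃ λ k → P k × (∀ {i} → i < k → ¬ P i)) →
    P d → ∃ λ k → P k × (∀ {j} → j < k → ¬ P j)
  search d below Pd with ℕ.anyUpTo? P? d
  ... | yes (j , j<d , Pj) = below j<d Pj
  ... | no none = d , Pd , λ j<d Pj → none (_ , j<d , Pj)

even-or-odd : ∀ d → ∃ λ e → d ≡ e + e ⊎ d ≡ suc (e + e)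
even-or-odd zero = 0 , inj₁ refl
even-or-odd (suc d) with even-or-odd d
... | e , inj₁ d≡2e = e , inj₂ (cong suc d≡2e)
... | e , inj₂ d≡2e+1 = suc e , inj₁ (trans (cong suc d≡2e+1) (cong suc (sym (ℕ.+-suc e e))))

-- CyclesEdge m k (i , a) (j , b) unfolds to i ≡ j × CyclicallyAdjacent k (toℕ a) (toℕ b).
CyclicallyAdjacent : ℕ → ℕ → ℕ → Set
CyclicallyAdjacent k a b = b ≡ suc a ⊎ a ≡ suc b ⊎ (a ≡ 0 × b ≡ k ∸ 1) ⊎ (b ≡ 0 × a ≡ k ∸ 1)

module NonBacktrackingWalks {n} (X : Graph n) (S : Fin n → Bool) (two-reg : TwoRegularInduced X S) where

  Arc : Set
  Arc = Fin n × Fin n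

  IsArc : Arc → Set
  IsArc (p , c) = S p ≡ true × S c ≡ true × adj X p c ≡ true

  adjS : Fin n → Fin n → Bool
  adjS c y = adj X c y ∧ S y

  -- The default c is junk: on an arc (p , c), c has a neighbour in S other than p.
  other : Fin n → Fin n → Fin n
  other c p = pick (adjS c except p) c

  next : Arc → Arc
  next (p , c) = c , other c p

  reverse : Arc → Arc
  reverse (p , c) = c , p

  walk : ℕ → Arc → Arc
  walk t a = fold a next t

  module _ {p c} (arc : IsArc (p , c)) where

    adjS-previous : adjS c p ≡ true
    adjS-previous = let Sp , _ , p~c = arc in cong₂ _∧_ (trans (Graph.sym X c p) p~c) Sp

    private
      other-spec : (adjS c except p) (other c p) ≡ true
      other-spec =
        let _ , Sc , _ = arc
            b , adjS-b , b≢p = count≡2-other (adjS c) (two-reg c Sc) adjS-previous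
        in pick-satisfies (adjS c except p) c (except-intro (adjS c) adjS-b b≢p)

    adjS-other : adjS c (other c p) ≡ true
    adjS-other = proj₁ (except-elim (adjS c) other-spec)

    other≢previous : other c p ≢ p
    other≢previous = proj₂ (except-elim (adjS c) other-spec)

    other-unique : ∀ {y} → adjS c y ≡ true → y ≢ p → y ≡ other c p
    other-unique adjS-y y≢p =
      count≡2-unique (adjS c) (two-reg c (proj₁ (proj₂ arc))) adjS-previous adjS-other other≢previous adjS-y y≢p

    next-arc : IsArc (next (p , c))
    next-arc = proj₁ (proj₂ arc) , Bool.∧-conicalʳ _ _ adjS-other , Bool.∧-conicalˡ _ _ adjS-other

  other-involutive : ∀ {p c} → IsArc (p , c) → other c (other c p) ≡ p
  other-involutive arc = sym (other-unique (reverse-arc (next-arc arc)) (adjS-previous arc) (other≢previous arc ∘ sym))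
    where
    reverse-arc : ∀ {a} → IsArc a → IsArc (reverse a)
    reverse-arc (Sp , Sc , p~c) = Sc , Sp , trans (Graph.sym X _ _) p~c

  next-reverse-next : ∀ {a} → IsArc a → next (reverse (next a)) ≡ reverse a
  next-reverse-next {p , c} arc = cong (c ,_) (other-involutive arc)

  next-injective : ∀ {a b} → IsArc a → IsArc b → next a ≡ next b → a ≡ b
  next-injective {p , c} {p′ , c′} arc arc′ next≡ = cong₂ _,_ p≡p′ c≡c′
    where
    c≡c′ = cong proj₁ next≡
    p≡p′ : p ≡ p′
    p≡p′ = begin
      p                      ≡⟨ other-involutive arc ⟨
      other c (other c p)    ≡⟨ cong₂ other c≡c′ (cong proj₂ next≡) ⟩
      other c′ (other c′ p′) ≡⟨ other-involutive arc′ ⟩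
      p′                     ∎
      where open ≡-Reasoning

  walk-arc : ∀ t {a} → IsArc a → IsArc (walk t a)
  walk-arc zero arc = arc
  walk-arc (suc t) arc = next-arc (walk-arc t arc)

  walk-injective : ∀ t {a b} → IsArc a → IsArc b → walk t a ≡ walk t b → a ≡ b
  walk-injective zero _ _ eq = eq
  walk-injective (suc t) arc arc′ eq = walk-injective t arc arc′ (next-injective (walk-arc t arc) (walk-arc t arc′) eq)

  walk-+ : ∀ t u a → walk (t + u) a ≡ walk t (walk u a)
  walk-+ t u a = fold-+ a next t

  reverse-walk : ∀ t r {u} → IsArc u → walk (t + r) u ≡ reverse u → reverse (walk t u) ≡ walk r u
  reverse-walk zero r _ eq = sym eq
  reverse-walk (suc t) r {u} arc eq = begin
    reverse (next (walk t u))                 ≡⟨ cong (reverse ∘ next) walk-t ⟩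
    reverse (next (reverse (next (walk r u)))) ≡⟨ cong reverse (next-reverse-next (walk-arc r arc)) ⟩
    walk r u                                  ∎
    where
    open ≡-Reasoning
    walk-t : walk t u ≡ reverse (next (walk r u))
    walk-t = cong reverse (reverse-walk t (suc r) arc (trans (cong (λ m → walk m u) (ℕ.+-suc t r)) eq))

  -- Folded onto its reverse, the walk's middle step would be a loop (d even) or a backtrack (d odd).
  no-palindrome : ∀ d {u} → IsArc u → walk d u ≢ reverse u
  no-palindrome d {u} arc eq with even-or-odd d
  ... | e , inj₁ refl =
    let _ , _ , p~c = walk-arc e arc
        p≡c = cong proj₂ (reverse-walk e e arc eq)
    in no-loop X (subst (λ y → adj X y (proj₂ (walk e u)) ≡ true) p≡c p~c)
  ... | e , inj₂ refl =
    other≢previous (walk-arc e arc)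
      (sym (cong proj₂ (reverse-walk e (suc e) arc (trans (cong (λ m → walk m u) (ℕ.+-suc e e)) eq))))

  Period : ℕ → Arc → Set
  Period k a = 0 < k × walk k a ≡ a

  LeastPeriod : ℕ → Arc → Set
  LeastPeriod k a = Period k a × (∀ {j} → j < k → ¬ Period j a)

  period? : ∀ a k → Dec (Period k a)
  period? a k = (0 ℕ.<? k) ×-dec ≡-dec _≟_ _≟_ (walk k a) a

  -- Pigeonhole on the n * n + 1 arcs walk 0 a, …, walk (n * n) a.
  period-exists : ∀ {a} → IsArc a → ∃ λ k → Period k a
  period-exists {a} arc =
    let i , j , i<j , encode≡ = Fin.pigeonhole (ℕ.n<1+n (n * n)) (λ i → encode (walk (toℕ i) a))
        d , 1+i+d≡j = ℕ.m≤n⇒∃[o]m+o≡n i<j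
        p , c = walk (toℕ i) a
        p′ , c′ = walk (toℕ j) a
        p≡p′ , c≡c′ = Fin.combine-injective p c p′ c′ encode≡
        walk-i≡walk-j = cong₂ _,_ p≡p′ c≡c′
    in suc d , s≤s z≤n ,
       walk-injective (toℕ i) (walk-arc (suc d) arc) arc (begin
         walk (toℕ i) (walk (suc d) a) ≡⟨ walk-+ (toℕ i) (suc d) a ⟨
         walk (toℕ i + suc d) a        ≡⟨ cong (λ m → walk m a) (trans (ℕ.+-suc (toℕ i) d) 1+i+d≡j) ⟩
         walk (toℕ j) a                ≡⟨ walk-i≡walk-j ⟨
         walk (toℕ i) a                ∎)
    where
    open ≡-Reasoning
    encode : Arc → Fin (n * n)
    encode (p , c) = combine p c

  least-period : ∀ {a} → IsArc a → ∃ λ k → LeastPeriod k a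
  least-period {a} arc = least (period? a) (proj₂ (period-exists arc))

  period≥3 : ∀ {k a} → IsArc a → Period k a → 3 ≤ k
  period≥3 {1} {p , c} (_ , _ , p~c) (_ , next≡) =
    ⊥-elim (no-loop X (subst (λ y → adj X p y ≡ true) (cong proj₁ next≡) p~c))
  period≥3 {2} arc (_ , next²≡) = ⊥-elim (other≢previous arc (cong proj₁ next²≡))
  period≥3 {suc (suc (suc _))} _ _ = s≤s (s≤s (s≤s z≤n))

  module Transport {σ : Permutation′ n} (aut : IsAut X σ) (S-invariant : ∀ x → S (σ ⟨$⟩ʳ x) ≡ S x) where

    mapArc : Arc → Arc
    mapArc (p , c) = σ ⟨$⟩ʳ p , σ ⟨$⟩ʳ c

    mapArc-arc : ∀ {a} → IsArc a → IsArc (mapArc a)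
    mapArc-arc (Sp , Sc , p~c) = trans (S-invariant _) Sp , trans (S-invariant _) Sc , trans (aut _ _) p~c

    mapArc-injective : ∀ {a b} → mapArc a ≡ mapArc b → a ≡ b
    mapArc-injective eq = cong₂ _,_ (⟨$⟩ʳ-injective σ (cong proj₁ eq)) (⟨$⟩ʳ-injective σ (cong proj₂ eq))

    mapArc-next : ∀ {a} → IsArc a → mapArc (next a) ≡ next (mapArc a)
    mapArc-next {p , c} arc =
      cong (σ ⟨$⟩ʳ c ,_) (other-unique (mapArc-arc arc) adjS-σ-other (other≢previous arc ∘ ⟨$⟩ʳ-injective σ))
      where
      adjS-σ-other : adjS (σ ⟨$⟩ʳ c) (σ ⟨$⟩ʳ other c p) ≡ true
      adjS-σ-other = cong₂ _∧_ (trans (aut _ _) (Bool.∧-conicalˡ _ _ (adjS-other arc)))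
                               (trans (S-invariant _) (Bool.∧-conicalʳ _ _ (adjS-other arc)))

    mapArc-walk : ∀ t {a} → IsArc a → mapArc (walk t a) ≡ walk t (mapArc a)
    mapArc-walk zero arc = refl
    mapArc-walk (suc t) arc = trans (mapArc-next (walk-arc t arc)) (cong next (mapArc-walk t arc))

    mapArc-least-period : ∀ {k a} → IsArc a → LeastPeriod k a → LeastPeriod k (mapArc a)
    mapArc-least-period {k} arc ((0<k , walk-k) , minimal) =
      (0<k , trans (sym (mapArc-walk k arc)) (cong mapArc walk-k)) ,
      λ {j} j<k (0<j , walk-j) → minimal j<k (0<j , mapArc-injective (trans (mapArc-walk j arc) walk-j))

  module Cycle {α} (α-arc : IsArc α) {k′} (α-period : LeastPeriod (suc k′) α) where

    open ≡-Reasoning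

    k : ℕ
    k = suc k′

    vertex : ℕ → Fin n
    vertex i = proj₂ (walk i α)

    vertex-S : ∀ i → S (vertex i) ≡ true
    vertex-S i = proj₁ (proj₂ (walk-arc i α-arc))

    vertex-k : vertex k ≡ vertex 0
    vertex-k = cong proj₂ (proj₂ (proj₁ α-period))

    vertex-distinct : ∀ {i j} → i < j → j < k → vertex i ≢ vertex j
    vertex-distinct {i} {j} i<j j<k vertex-i≡vertex-j
      with ℕ.m≤n⇒∃[o]m+o≡n i<j | proj₁ (walk i α) ≟ proj₁ (walk j α)
    ... | d , 1+i+d≡j | yes same-previous =
      proj₂ α-period (ℕ.≤-<-trans (s≤s (ℕ.m≤n+m d i)) (subst (_< k) (sym 1+i+d≡j) j<k))
        (s≤s z≤n , walk-injective i (walk-arc (suc d) α-arc) α-arc (begin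
          walk i (walk (suc d) α) ≡⟨ walk-+ i (suc d) α ⟨
          walk (i + suc d) α      ≡⟨ cong (λ m → walk m α) (trans (ℕ.+-suc i d) 1+i+d≡j) ⟩
          walk j α                ≡⟨ cong₂ _,_ same-previous vertex-i≡vertex-j ⟨
          walk i α                ∎))
    ... | d , 1+i+d≡j | no other-previous =
      no-palindrome d (walk-arc (suc i) α-arc) (begin
        walk d (walk (suc i) α)   ≡⟨ walk-+ d (suc i) α ⟨
        walk (d + suc i) α        ≡⟨ cong (λ m → walk m α) (trans (ℕ.+-comm d (suc i)) 1+i+d≡j) ⟩
        walk j α                  ≡⟨ cong₂ _,_ previous-j≡other (sym vertex-i≡vertex-j) ⟩
        reverse (next (walk i α)) ∎)
      where
      previous-j≡other : proj₁ (walk j α) ≡ other (vertex i) (proj₁ (walk i α))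
      previous-j≡other =
        let Sp , _ , p~c = walk-arc j α-arc
        in other-unique (walk-arc i α-arc)
             (cong₂ _∧_ (trans (cong (λ y → adj X y _) vertex-i≡vertex-j) (trans (Graph.sym X _ _) p~c)) Sp)
             (other-previous ∘ sym)

    vertex-injective : ∀ {i j} → i < k → j < k → vertex i ≡ vertex j → i ≡ j
    vertex-injective {i} {j} i<k j<k eq with ℕ.<-cmp i j
    ... | tri< i<j _ _ = ⊥-elim (vertex-distinct i<j j<k eq)
    ... | tri≈ _ i≡j _ = i≡j
    ... | tri> _ _ j<i = ⊥-elim (vertex-distinct j<i i<k (sym eq))

    private
      step-adjacent : ∀ i → adj X (vertex i) (vertex (suc i)) ≡ true
      step-adjacent i = proj₂ (proj₂ (walk-arc (suc i) α-arc))

      closing-adjacent : adj X (vertex k′) (vertex 0) ≡ true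
      closing-adjacent = subst (λ y → adj X (vertex k′) y ≡ true) vertex-k (step-adjacent k′)

    vertex-adjacent : ∀ {i j} → CyclicallyAdjacent k i j → adj X (vertex i) (vertex j) ≡ true
    vertex-adjacent {i} (inj₁ refl) = step-adjacent i
    vertex-adjacent {j = j} (inj₂ (inj₁ refl)) = trans (Graph.sym X _ _) (step-adjacent j)
    vertex-adjacent (inj₂ (inj₂ (inj₁ (refl , refl)))) = trans (Graph.sym X _ _) closing-adjacent
    vertex-adjacent (inj₂ (inj₂ (inj₂ (refl , refl)))) = closing-adjacent

    CycleNeighbour : ℕ → Fin n → Set
    CycleNeighbour i y = ∃ λ (b : Fin k) → y ≡ vertex (toℕ b) × CyclicallyAdjacent k i (toℕ b)

    private
      at : ∀ {i y} j → j < k → y ≡ vertex j → CyclicallyAdjacent k i j → CycleNeighbour i y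
      at {i} {y} j j<k y≡vertex-j i~j = fromℕ< j<k ,
        subst (λ m → y ≡ vertex m × CyclicallyAdjacent k i m) (sym (Fin.toℕ-fromℕ< j<k)) (y≡vertex-j , i~j)

      behind : ∀ {y} i → i < k → y ≡ proj₁ (walk i α) → CycleNeighbour i y
      behind zero _ y≡previous =
        at k′ ℕ.≤-refl (trans y≡previous (cong proj₁ (sym (proj₂ (proj₁ α-period)))))
          (inj₂ (inj₂ (inj₁ (refl , refl))))
      behind (suc i′) (s≤s i′<k′) y≡previous = at i′ (ℕ.m≤n⇒m≤1+n i′<k′) y≡previous (inj₂ (inj₁ refl))

      ahead : ∀ {i y} → i < k → y ≡ vertex (suc i) → CycleNeighbour i y
      ahead {i} i<k y≡next with suc i ℕ.<? k
      ... | yes 1+i<k = at (suc i) 1+i<k y≡next (inj₁ refl)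
      ... | no 1+i≮k =
        let 1+i≡k = ℕ.≤-antisym i<k (ℕ.≮⇒≥ 1+i≮k)
        in at 0 (s≤s z≤n) (trans y≡next (trans (cong vertex 1+i≡k) vertex-k))
             (inj₂ (inj₂ (inj₂ (refl , cong (_∸ 1) 1+i≡k))))

    neighbour-on-cycle : ∀ {i y} → i < k → S y ≡ true → adj X (vertex i) y ≡ true → CycleNeighbour i y
    neighbour-on-cycle {i} {y} i<k Sy i~y with y ≟ proj₁ (walk i α)
    ... | yes y≡previous = behind i i<k y≡previous
    ... | no y≢previous = ahead i<k (other-unique (walk-arc i α-arc) (cong₂ _∧_ i~y Sy) y≢previous)

  module CycleDecomposition (k′ : ℕ)
    (through : ∀ {v} → S v ≡ true → ∃ λ α → IsArc α × LeastPeriod (suc k′) α × proj₂ α ≡ v) where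

    CyclesIso : (Fin n → Bool) → Set
    CyclesIso T = ∃ λ m → GraphIso (IVertex T) (Fin m × Fin (suc k′)) (IEdge X T) (CyclesEdge m (suc k′))

    record UnionOfComponents (T : Fin n → Bool) : Set where
      field
        ⊆S : ∀ {x} → T x ≡ true → S x ≡ true
        closed : ∀ {x y} → T x ≡ true → S y ≡ true → adj X x y ≡ true → T y ≡ true

    no-cycles : ∀ {T} → (∀ x → T x ≢ true) → CyclesIso T
    no-cycles none = 0 , record
      { bij = mk↔ₛ′ (λ (x , Tx) → ⊥-elim (none x Tx)) (λ { (() , _) })
                    (λ { (() , _) }) (λ (x , Tx) → ⊥-elim (none x Tx))
      ; preserve = λ (x , Tx) _ → ⊥-elim (none x Tx)
      }

    module Peel {T} (T-components : UnionOfComponents T) {v} (Tv : T v ≡ true) where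
      open UnionOfComponents T-components

      private
        through-v = through (⊆S Tv)
        α-arc = proj₁ (proj₂ through-v)
        α-period = proj₁ (proj₂ (proj₂ through-v))
        α-ends-at-v = proj₂ (proj₂ (proj₂ through-v))

      open Cycle α-arc α-period

      onCycle : Fin n → Bool
      onCycle x = does (Fin.any? (λ (i : Fin k) → vertex (toℕ i) ≟ x))

      onCycle-index : ∀ {x} → onCycle x ≡ true → ∃ λ (i : Fin k) → vertex (toℕ i) ≡ x
      onCycle-index {x} = from-does-true (Fin.any? (λ (i : Fin k) → vertex (toℕ i) ≟ x))

      onCycle-vertex : ∀ (i : Fin k) → onCycle (vertex (toℕ i)) ≡ true
      onCycle-vertex i = dec-true (Fin.any? (λ (j : Fin k) → vertex (toℕ j) ≟ vertex (toℕ i))) (i , refl)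

      vertex-T : ∀ i → T (vertex i) ≡ true
      vertex-T zero = subst (λ y → T y ≡ true) (sym α-ends-at-v) Tv
      vertex-T (suc i) = closed (vertex-T i) (vertex-S (suc i)) (proj₂ (proj₂ (walk-arc (suc i) α-arc)))

      onCycle-closed : ∀ {x y} → S x ≡ true → onCycle y ≡ true → adj X y x ≡ true → onCycle x ≡ true
      onCycle-closed Sx on-y y~x =
        let i , vertex-i≡y = onCycle-index on-y
            b , x≡vertex-b , _ = neighbour-on-cycle (Fin.toℕ<n i) Sx
                                   (subst (λ z → adj X z _ ≡ true) (sym vertex-i≡y) y~x)
        in subst (λ z → onCycle z ≡ true) (sym x≡vertex-b) (onCycle-vertex b)

      rest : Fin n → Bool
      rest x = T x ∧ not (onCycle x)

      rest-components : UnionOfComponents rest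
      rest-components = record
        { ⊆S = ⊆S ∘ Bool.∧-conicalˡ _ _
        ; closed = λ {x} {y} rest-x Sy x~y → rest-closed rest-x Sy x~y (onCycle y) refl
        }
        where
        rest-closed : ∀ {x y} → rest x ≡ true → S y ≡ true → adj X x y ≡ true →
          ∀ b → onCycle y ≡ b → rest y ≡ true
        rest-closed rest-x Sy x~y false off-y = cong₂ _∧_ (closed (Bool.∧-conicalˡ _ _ rest-x) Sy x~y) (cong not off-y)
        rest-closed {x} rest-x Sy x~y true on-y with () ←
          trans (sym (cong not (onCycle-closed (⊆S (Bool.∧-conicalˡ _ _ rest-x)) on-y (trans (Graph.sym X _ _) x~y))))
                (Bool.∧-conicalʳ (T x) _ rest-x)

      rest-smaller : count rest < count T
      rest-smaller = begin-strict
        count rest                                          <⟨ ℕ.m<n+m _ (count-pos _ {v} (cong₂ _∧_ Tv on-v)) ⟩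
        count (λ x → T x ∧ onCycle x) + count rest          ≡⟨ count-split T onCycle ⟨
        count T                                             ∎
        where
        open ℕ.≤-Reasoning
        on-v : onCycle v ≡ true
        on-v = subst (λ y → onCycle y ≡ true) α-ends-at-v (onCycle-vertex zero)

      module Extend (rest-cycles : CyclesIso rest) where
        private
          m = proj₁ rest-cycles
          ι = proj₂ rest-cycles
          module ι = Inverse (GraphIso.bij ι)

        toWith : ∀ x → T x ≡ true → ∀ b → onCycle x ≡ b → Fin (suc m) × Fin k
        toWith x Tx true on = zero , proj₁ (onCycle-index on)
        toWith x Tx false off = let j , i = ι.to (x , cong₂ _∧_ Tx (cong not off)) in suc j , i

        to : IVertex T → Fin (suc m) × Fin k
        to (x , Tx) = toWith x Tx (onCycle x) refl

        from : Fin (suc m) × Fin k → IVertex T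
        from (zero , i) = vertex (toℕ i) , vertex-T (toℕ i)
        from (suc j , i) = let x , rest-x = ι.from (j , i) in x , Bool.∧-conicalˡ _ _ rest-x

        index-injective : ∀ {i i′ : Fin k} → vertex (toℕ i) ≡ vertex (toℕ i′) → i ≡ i′
        index-injective eq =
          Fin.toℕ-injective (vertex-injective (Fin.toℕ<n _) (Fin.toℕ<n _) eq)

        to-from : ∀ y → to (from y) ≡ y
        to-from (zero , i) = on-cycle (onCycle (vertex (toℕ i))) refl
          where
          on-cycle : ∀ b (on : onCycle (vertex (toℕ i)) ≡ b) → toWith _ (vertex-T (toℕ i)) b on ≡ (zero , i)
          on-cycle true on = cong (zero ,_) (index-injective (proj₂ (onCycle-index on)))
          on-cycle false off with () ← trans (sym off) (onCycle-vertex i)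
        to-from (suc j , i) = off-cycle (onCycle x) refl
          where
          x = proj₁ (ι.from (j , i))
          rest-x = proj₂ (ι.from (j , i))
          off-cycle : ∀ b (on : onCycle x ≡ b) → toWith x (Bool.∧-conicalˡ _ _ rest-x) b on ≡ (suc j , i)
          off-cycle true on with () ← trans (sym (cong not on)) (Bool.∧-conicalʳ _ _ rest-x)
          off-cycle false off = cong (λ (j , i) → suc j , i) (trans (cong ι.to (IVertex-≡ refl)) (ι.strictlyInverseˡ (j , i)))

        from-to : ∀ x → from (to x) ≡ x
        from-to (x , Tx) = cases (onCycle x) refl
          where
          cases : ∀ b (on : onCycle x ≡ b) → from (toWith x Tx b on) ≡ (x , Tx)
          cases true on = IVertex-≡ (proj₂ (onCycle-index on))
          cases false off = IVertex-≡ (cong proj₁ (ι.strictlyInverseʳ (x , cong₂ _∧_ Tx (cong not off))))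

        preserve : ∀ a b → IEdge X T a b ⇔ CyclesEdge (suc m) k (to a) (to b)
        preserve (x , Tx) (y , Ty) = cases (onCycle x) refl (onCycle y) refl
          where
          cases : ∀ b (on-x : onCycle x ≡ b) b′ (on-y : onCycle y ≡ b′) →
            (adj X x y ≡ true) ⇔ CyclesEdge (suc m) k (toWith x Tx b on-x) (toWith y Ty b′ on-y)
          cases true on-x true on-y =
            let i , vertex-i≡x = onCycle-index on-x
                i′ , vertex-i′≡y = onCycle-index on-y
            in mk⇔
              (λ x~y → let b , y≡vertex-b , i~b = neighbour-on-cycle (Fin.toℕ<n i) (⊆S Ty)
                                                    (subst (λ z → adj X z y ≡ true) (sym vertex-i≡x) x~y)
                       in refl , subst (λ b → CyclicallyAdjacent k (toℕ i) (toℕ b))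
                                       (index-injective (trans (sym y≡vertex-b) (sym vertex-i′≡y))) i~b)
              (λ (_ , i~i′) → subst₂ (λ z w → adj X z w ≡ true) vertex-i≡x vertex-i′≡y (vertex-adjacent i~i′))
          cases true on-x false off-y = mk⇔
            (λ x~y → ⊥-elim (true≢false (trans (sym (onCycle-closed (⊆S Ty) on-x x~y)) off-y)))
            (λ { (() , _) })
          cases false off-x true on-y = mk⇔
            (λ x~y → ⊥-elim (true≢false (trans (sym (onCycle-closed (⊆S Tx) on-y (trans (Graph.sym X _ _) x~y))) off-x)))
            (λ { (() , _) })
          cases false off-x false off-y =
            let ι-preserve = GraphIso.preserve ι (x , cong₂ _∧_ Tx (cong not off-x)) (y , cong₂ _∧_ Ty (cong not off-y))
            in mk⇔ (λ x~y → let j≡j′ , i~i′ = Equivalence.to ι-preserve x~y in cong suc j≡j′ , i~i′)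
                   (λ (j≡j′ , i~i′) → Equivalence.from ι-preserve (Fin.suc-injective j≡j′ , i~i′))

        extended : CyclesIso T
        extended = suc m , record { bij = mk↔ₛ′ to from to-from from-to ; preserve = preserve }

    decompose : ∀ fuel T → count T ≤ fuel → UnionOfComponents T → CyclesIso T
    decompose fuel T count≤fuel T-components with Fin.any? (λ x → T x Bool.≟ true)
    ... | no none = no-cycles (λ x Tx → none (x , Tx))
    decompose zero T count≤0 _ | yes (v , Tv) = ⊥-elim (ℕ.<⇒≱ (count-pos T Tv) count≤0)
    decompose (suc fuel) T count≤fuel T-components | yes (v , Tv) =
      Peel.Extend.extended T-components Tv
        (decompose fuel (Peel.rest T-components Tv) (ℕ.≤-pred (ℕ.<-≤-trans (Peel.rest-smaller T-components Tv) count≤fuel))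
                   (Peel.rest-components T-components Tv))

    S-cycles : CyclesIso S
    S-cycles = decompose (count S) S ℕ.≤-refl (record { ⊆S = id ; closed = λ _ Sy _ → Sy })

-- Every vertex of S is the head of an image of the arc α₀ under the stabiliser of S, so every cycle
-- of X[S] has the length of the cycle through α₀.
two-regular-transitive⇒cycles : ∀ {n} (X : Graph n) (S : Fin n → Bool) → TwoRegularInduced X S →
  ∀ {u} → S u ≡ true →
  (∀ {v} → S v ≡ true → ∃ λ σ → IsAut X σ × (∀ x → S (σ ⟨$⟩ʳ x) ≡ S x) × σ ⟨$⟩ʳ u ≡ v) →
  ∃ λ m → ∃ λ k → 3 ≤ k × GraphIso (IVertex S) (Fin m × Fin k) (IEdge X S) (CyclesEdge m k)
two-regular-transitive⇒cycles X S two-reg {u} Su transitive = from-least-period (least-period α₀-arc)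
  where
  open NonBacktrackingWalks X S two-reg
  w~u = count-witness (adjS u) (subst (0 <_) (sym (two-reg u Su)) (s≤s z≤n))
  α₀ = proj₁ w~u , u
  α₀-arc : IsArc α₀
  α₀-arc = Bool.∧-conicalʳ _ _ (proj₂ w~u) , Su , trans (Graph.sym X _ _) (Bool.∧-conicalˡ _ _ (proj₂ w~u))
  from-least-period : (∃ λ k → LeastPeriod k α₀) →
    ∃ λ m → ∃ λ k → 3 ≤ k × GraphIso (IVertex S) (Fin m × Fin k) (IEdge X S) (CyclesEdge m k)
  from-least-period (zero , (() , _) , _)
  from-least-period (suc k′ , α₀-period) =
    proj₁ S-cycles , suc k′ , period≥3 α₀-arc (proj₁ α₀-period) , proj₂ S-cycles
    where
    through : ∀ {v} → S v ≡ true → ∃ λ α → IsArc α × LeastPeriod (suc k′) α × proj₂ α ≡ v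
    through Sv = let σ , aut , S-invariant , σu≡v = transitive Sv
                     open Transport {σ} aut S-invariant
                 in mapArc α₀ , mapArc-arc α₀-arc , mapArc-least-period α₀-arc α₀-period , σu≡v
    open CycleDecomposition k′ through using (S-cycles)

-- Partitions preserved or swapped by all automorphisms

preserved-or-swapped-complement : ∀ {n} (X : Graph n) {s B} → (∀ x → B x ≡ not (s x)) →
  PreservedOrSwapped X s → PreservedOrSwapped X B
preserved-or-swapped-complement X {s} {B} B≗¬s preserved-or-swapped σ aut =
  Sum.map (λ preserved x → trans (B≗¬s _) (trans (cong not (preserved x)) (sym (B≗¬s x))))
          (λ swapped x → trans (B≗¬s _) (trans (cong not (swapped x)) (cong not (sym (B≗¬s x)))))
          (preserved-or-swapped σ aut)

preserved-or-swapped⇒block : ∀ {n} (X : Graph n) {B} → PreservedOrSwapped X B → IsBlock X B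
preserved-or-swapped⇒block X {B} preserved-or-swapped σ aut =
  Sum.map (λ preserved x → mk⇔ (trans (preserved x)) (trans (sym (preserved x))))
          (λ swapped x Bx Bσx → true≢false (trans (sym Bσx) (trans (swapped x) (cong not Bx))))
          (preserved-or-swapped σ aut)

aut-restricts-to-iso : ∀ {n} (X : Graph n) {σ : Permutation′ n} → IsAut X σ → ∀ {S T} →
  (∀ x → T (σ ⟨$⟩ʳ x) ≡ S x) → GraphIso (IVertex S) (IVertex T) (IEdge X S) (IEdge X T)
aut-restricts-to-iso X {σ} aut {S} {T} T∘σ≗S = record
  { bij = mk↔ₛ′ (λ (x , Sx) → σ ⟨$⟩ʳ x , trans (T∘σ≗S x) Sx)
                (λ (y , Ty) → σ ⟨$⟩ˡ y , trans (sym (T∘σ≗S (σ ⟨$⟩ˡ y))) (trans (cong T (inverseʳ σ)) Ty))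
                (λ _ → IVertex-≡ (inverseʳ σ)) (λ _ → IVertex-≡ (inverseˡ σ))
  ; preserve = λ _ _ → mk⇔ (trans (aut _ _)) (trans (sym (aut _ _)))
  }

crossing : ∀ {n} → Graph n → (Fin n → Bool) → Fin n → Fin n → Bool
crossing X s x y = adj X x y ∧ (s x xor s y)

crossing-perfect-matching : ∀ {n} (X : Graph n) → Cubic X → ∀ {s} →
  TwoRegularInduced X s → TwoRegularInduced X (not ∘ s) → PerfectMatching (crossing X s)
crossing-perfect-matching X cubic {s} two-reg two-reg-not x = cases (s x) refl
  where
  cases : ∀ b → s x ≡ b → count (λ y → adj X x y ∧ (b xor s y)) ≡ 1
  cases true sx = two-regular⇒cross-degree-one X cubic s two-reg x sx
  cases false ¬sx = trans (count-cong (λ y → cong (adj X x y ∧_) (sym (Bool.not-involutive (s y)))))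
                          (two-regular⇒cross-degree-one X cubic (not ∘ s) two-reg-not x (cong not ¬sx))

crossing-invariant : ∀ {n} (X : Graph n) {s} → PreservedOrSwapped X s → FixesSetwise X (crossing X s)
crossing-invariant X {s} preserved-or-swapped σ aut x y =
  cong₂ _∧_ (aut x y) ([ (λ preserved → cong₂ _xor_ (preserved x) (preserved y))
                       , (λ swapped → trans (cong₂ _xor_ (swapped x) (swapped y)) (not-xor-not (s x) (s y))) ]′
                       (preserved-or-swapped σ aut))
  where
  not-xor-not : ∀ a b → not a xor not b ≡ a xor b
  not-xor-not true b = refl
  not-xor-not false b = Bool.not-involutive b

invariant-matching-arc-transitive : ∀ {n} (X : Graph n) {M} → VertexTransitive X → PerfectMatching M →
  FixesSetwise X M → ArcTransitiveOn X M
invariant-matching-arc-transitive X {M} transitive matching invariant x y x′ y′ Mxy Mx′y′ =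
  let σ , aut , σx≡x′ = transitive x x′
      Mx′σy = trans (cong (λ w → M w (σ ⟨$⟩ʳ y)) (sym σx≡x′)) (trans (invariant σ aut x y) Mxy)
  in σ , aut , σx≡x′ , count≡1-unique (M x′) (matching x′) Mx′y′ Mx′σy

sides-nonempty : ∀ {n} (X : Graph n) → Cubic X → ∀ {s} → TwoRegularInduced X s → TwoRegularInduced X (not ∘ s) →
  Fin n → (∃ λ x → s x ≡ true) × (∃ λ x → not (s x) ≡ true)
sides-nonempty X cubic {s} two-reg two-reg-not x =
  let y , x~y = count-witness (crossing X s x)
                  (subst (0 <_) (sym (crossing-perfect-matching X cubic two-reg two-reg-not x)) (s≤s z≤n))
  in cases (s x) refl y (Bool.∧-conicalʳ _ _ x~y)
  where
  cases : ∀ b → s x ≡ b → ∀ y → b xor s y ≡ true → (∃ λ x → s x ≡ true) × (∃ λ x → not (s x) ≡ true)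
  cases true sx y ¬sy = (x , sx) , (y , ¬sy)
  cases false ¬sx y sy = (y , sy) , (x , cong not ¬sx)

module _ {n} (X : Graph n) (transitive : VertexTransitive X) {s} (preserved-or-swapped : PreservedOrSwapped X s) where

  stabiliser-transitive : ∀ {u v} → s u ≡ true → s v ≡ true →
    ∃ λ σ → IsAut X σ × (∀ x → s (σ ⟨$⟩ʳ x) ≡ s x) × σ ⟨$⟩ʳ u ≡ v
  stabiliser-transitive {u} {v} su sv with transitive u v
  ... | σ , aut , σu≡v with preserved-or-swapped σ aut
  ...   | inj₁ preserved = σ , aut , preserved , σu≡v
  ...   | inj₂ swapped =
    ⊥-elim (true≢false (trans (sym sv) (trans (cong s (sym σu≡v)) (trans (swapped u) (cong not su)))))

  swapping-aut : ∀ {u v} → s u ≡ true → not (s v) ≡ true →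
    ∃ λ σ → IsAut X σ × (∀ x → s (σ ⟨$⟩ʳ x) ≡ not (s x))
  swapping-aut {u} {v} su ¬sv with transitive u v
  ... | σ , aut , σu≡v with preserved-or-swapped σ aut
  ...   | inj₁ preserved =
    ⊥-elim (true≢false (trans (sym ¬sv) (cong not (trans (cong s (sym σu≡v)) (trans (preserved u) su)))))
  ...   | inj₂ swapped = σ , aut , swapped

module ±1-Eigenvector {n} (X : Graph n) (cubic : Cubic X) (simple : SimpleEigenvalue X 1ℚ)
  {z : Fin n → ℚ} (±1 : ∀ x → z x ≡ 1ℚ ⊎ z x ≡ - 1ℚ) (eigen : ∀ x → adjMul X z x ≡ 1ℚ ℚ.* z x) where

  private
    on-±1 : (P : ℚ → Set) → P 1ℚ → P (- 1ℚ) → ∀ x → P (z x)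
    on-±1 P P1 P-1 x = [ (λ z≡1 → subst P (sym z≡1) P1) , (λ z≡-1 → subst P (sym z≡-1) P-1) ]′ (±1 x)

  z≡sign-Vplus : ∀ x → z x ≡ sign (Vplus z x)
  z≡sign-Vplus = on-±1 (λ q → q ≡ sign ⌊ q ℚ.≟ 1ℚ ⌋) refl refl

  Vminus≡not-Vplus : ∀ x → Vminus z x ≡ not (Vplus z x)
  Vminus≡not-Vplus = on-±1 (λ q → ⌊ q ℚ.≟ - 1ℚ ⌋ ≡ not ⌊ q ℚ.≟ 1ℚ ⌋) refl refl

  Vplus-two-regular : TwoRegularInduced X (Vplus z)
  Vplus-two-regular = proj₁ (eigenvector⇒two-regular X cubic (Vplus z) z z≡sign-Vplus eigen)

  not-Vplus-two-regular : TwoRegularInduced X (not ∘ Vplus z)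
  not-Vplus-two-regular = proj₂ (eigenvector⇒two-regular X cubic (Vplus z) z z≡sign-Vplus eigen)

  Vminus-two-regular : TwoRegularInduced X (Vminus z)
  Vminus-two-regular = two-regular-cong X (sym ∘ Vminus≡not-Vplus) not-Vplus-two-regular

  Vplus-preserved-or-swapped : PreservedOrSwapped X (Vplus z)
  Vplus-preserved-or-swapped = aut-preserves-or-swaps X cubic simple (Vplus z) z z≡sign-Vplus eigen

  Vminus-preserved-or-swapped : PreservedOrSwapped X (Vminus z)
  Vminus-preserved-or-swapped = preserved-or-swapped-complement X Vminus≡not-Vplus Vplus-preserved-or-swapped

  sides : Fin n → (∃ λ x → x ∈ Vplus z) × (∃ λ x → x ∈ Vminus z)
  sides x₀ =
    let (x₊ , V⁺x₊) , (x₋ , ¬V⁺x₋) = sides-nonempty X cubic Vplus-two-regular not-Vplus-two-regular x₀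
    in (x₊ , V⁺x₊) , (x₋ , trans (Vminus≡not-Vplus x₋) ¬V⁺x₋)

  Vplus≅Vminus : VertexTransitive X → Fin n →
    GraphIso (IVertex (Vplus z)) (IVertex (Vminus z)) (IEdge X (Vplus z)) (IEdge X (Vminus z))
  Vplus≅Vminus transitive x₀ =
    let (_ , V⁺x₊) , (x₋ , V⁻x₋) = sides x₀
        σ , aut , swapped = swapping-aut X transitive Vplus-preserved-or-swapped V⁺x₊
                              (trans (sym (Vminus≡not-Vplus x₋)) V⁻x₋)
    in aut-restricts-to-iso X {σ} aut
         (λ x → trans (Vminus≡not-Vplus _) (trans (cong not (swapped x)) (Bool.not-involutive _)))

  two-regular-partition-is-sides : ∀ (P : Fin n → Bool) → TwoRegularInduced X P → TwoRegularInduced X (not ∘ P) →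
    (∀ x → (P x ≡ true) ⇔ (x ∈ Vplus z)) ⊎ (∀ x → (P x ≡ true) ⇔ (x ∈ Vminus z))
  two-regular-partition-is-sides P two-reg two-reg-not =
    Sum.map (λ P≗V⁺ x → mk⇔ (trans (sym (P≗V⁺ x))) (trans (P≗V⁺ x)))
            (λ P≗¬V⁺ x → let P≗V⁻ = trans (P≗¬V⁺ x) (sym (Vminus≡not-Vplus x))
                         in mk⇔ (trans (sym P≗V⁻)) (trans P≗V⁻))
            (two-regular-partition-unique X cubic simple (Vplus z) z z≡sign-Vplus eigen P two-reg two-reg-not)

  inM≡crossing : ∀ x y → inM X z x y ≡ crossing X (Vplus z) x y
  inM≡crossing x y = cong (adj X x y ∧_) (begin
    (Vplus z x ∧ Vminus z y) ∨ (Vminus z x ∧ Vplus z y)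
      ≡⟨ cong₂ (λ a b → (Vplus z x ∧ a) ∨ (b ∧ Vplus z y)) (Vminus≡not-Vplus y) (Vminus≡not-Vplus x) ⟩
    (Vplus z x ∧ not (Vplus z y)) ∨ (not (Vplus z x) ∧ Vplus z y)
      ≡⟨ xor-as-∨ (Vplus z x) (Vplus z y) ⟩
    Vplus z x xor Vplus z y ∎)
    where
    open ≡-Reasoning
    xor-as-∨ : ∀ a b → (a ∧ not b) ∨ (not a ∧ b) ≡ a xor b
    xor-as-∨ true b = Bool.∨-identityʳ (not b)
    xor-as-∨ false b = refl

  inM-perfect-matching : PerfectMatching (inM X z)
  inM-perfect-matching x =
    trans (count-cong (inM≡crossing x)) (crossing-perfect-matching X cubic Vplus-two-regular not-Vplus-two-regular x)

  inM-invariant : FixesSetwise X (inM X z)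
  inM-invariant σ aut x y =
    trans (inM≡crossing _ _) (trans (crossing-invariant X Vplus-preserved-or-swapped σ aut x y) (sym (inM≡crossing x y)))

lemma4p1 : ∀ {n : ℕ} (X : Graph n) → Cubic X → VertexTransitive X →
  SimpleEigenvalue X 1ℚ →
  (z : Fin n → ℚ) → (∀ x → z x ≡ 1ℚ ⊎ z x ≡ - 1ℚ) → IsEigenvector X 1ℚ z →
  -- (i)
  (Σ ℕ (λ m → Σ ℕ (λ k → 3 ≤ k ×
    GraphIso (IVertex (Vplus z)) (Fin m × Fin k) (IEdge X (Vplus z)) (CyclesEdge m k))))
  -- (ii)
  × GraphIso (IVertex (Vplus z)) (IVertex (Vminus z)) (IEdge X (Vplus z)) (IEdge X (Vminus z))
  × IsBlock X (Vplus z) × IsBlock X (Vminus z)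
  -- (iii)
  × (Σ (Fin n) (λ x → x ∈ Vplus z)) × (Σ (Fin n) (λ x → x ∈ Vminus z))
  × TwoRegularInduced X (Vplus z) × TwoRegularInduced X (Vminus z)
  × (∀ (P : Subset n) → Σ (Fin n) (λ x → P x ≡ true) → Σ (Fin n) (λ x → P x ≡ false) →
       TwoRegularInduced X P → TwoRegularInduced X (λ x → not (P x)) →
       (∀ x → (P x ≡ true) ⇔ (x ∈ Vplus z)) ⊎ (∀ x → (P x ≡ true) ⇔ (x ∈ Vminus z)))
  -- (iv)
  × PerfectMatching (inM X z)
  -- (v)
  × FixesSetwise X (inM X z) × ArcTransitiveOn X (inM X z)
lemma4p1 X cubic transitive simple z ±1 ((x₀ , _) , eigen) =
  two-regular-transitive⇒cycles X (Vplus z) Vplus-two-regular V⁺x₊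
    (stabiliser-transitive X transitive Vplus-preserved-or-swapped V⁺x₊) ,
  Vplus≅Vminus transitive x₀ ,
  preserved-or-swapped⇒block X Vplus-preserved-or-swapped ,
  preserved-or-swapped⇒block X Vminus-preserved-or-swapped ,
  proj₁ (sides x₀) , proj₂ (sides x₀) ,
  Vplus-two-regular , Vminus-two-regular ,
  (λ P _ _ → two-regular-partition-is-sides P) ,
  inM-perfect-matching ,
  inM-invariant , invariant-matching-arc-transitive X transitive inM-perfect-matching inM-invariant
  where
  open ±1-Eigenvector X cubic simple ±1 eigen
  V⁺x₊ = proj₂ (proj₁ (sides x₀))
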